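{- Let $r\in\mathbb{R}$. For all integers $n,m,k\ge 0$ with $n\ge m+k$, $$\binom{m+k}{m}S_{2,r}(n,m+k)=\sum_{n_1=m}^{n}\sum_{l=0}^{m}\sum_{j=0}^{k}\binom{n_1}{l}\binom{n-n_1}{j}\binom{n}{n_1}r^{l+j}S_2(n_1-l,m-l)\,S_2(n-n_1-j,k-j).$$
   Context: $S_2(n,k)$ denotes the Stirling numbers of the second kind, given by $\frac{1}{k!}(e^t-1)^k=\sum_{n=k}^\infty S_2(n,k)\frac{t^n}{n!}$, with the convention $S_2(a,b)=0$ whenever $a<b$ (including negative $a$), and $\binom{a}{b}=0$ for $b>a\ge0$. For $r\in\mathbb{R}$ and integers $k\ge0$, the extended Stirling numbers of the second kind $S_{2,r}(n,k)$ are defined by $\frac{1}{k!}(e^t-1+rt)^k=\sum_{n=k}^\infty S_{2,r}(n,k)\frac{t^n}{n!}$. -}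

module Defs where

open import Level using (Level)
open import Data.Nat using (ℕ; zero; suc; _∸_)
import Data.Nat as N
open import Data.Nat.Combinatorics using (_C_)
open import Algebra.Bundles using (CommutativeRing)

-- Stirling numbers of the second kind S₂(n,k) (natural numbers), via the
-- derivative of their EGF  F_k = (e^t-1)^k/k! :  F_k' = e^t F_{k-1},
-- i.e.  S₂(n+1,k+1) = Σ_{i=0}^{n} C(n,i) S₂(n-i,k).
-- Out-of-range values (n < k) are 0 automatically.
sumℕ : ℕ → (ℕ → ℕ) → ℕ
sumℕ zero    f = 0
sumℕ (suc n) f = sumℕ n f N.+ f n

S₂ : ℕ → ℕ → ℕ
S₂ zero    zero    = 1
S₂ zero    (suc k) = 0
S₂ (suc n) zero    = 0
S₂ (suc n) (suc k) = sumℕ (suc n) (λ i → (n C i) N.* S₂ (n ∸ i) k)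

module _ {c ℓ : Level} (R : CommutativeRing c ℓ) where
  open CommutativeRing R

  Σ< : ℕ → (ℕ → Carrier) → Carrier
  Σ< zero    f = 0#
  Σ< (suc n) f = Σ< n f + f n

  -- Σ_{i=a}^{b} f i  (empty if b < a)
  Σ[_⋯_] : ℕ → ℕ → (ℕ → Carrier) → Carrier
  Σ[ a ⋯ b ] f = Σ< (suc b ∸ a) (λ i → f (a N.+ i))

  ι : ℕ → Carrier
  ι zero    = 0#
  ι (suc n) = 1# + ι n

  pow : Carrier → ℕ → Carrier
  pow x zero    = 1#
  pow x (suc n) = x * pow x n

  -- EGF coefficients of f(t) = e^t - 1 + r t :  a_0 = 0, a_1 = 1 + r, a_j = 1 (j ≥ 2)
  egfCoeff : Carrier → ℕ → Carrier
  egfCoeff r zero          = 0#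
  egfCoeff r (suc zero)    = 1# + r
  egfCoeff r (suc (suc j)) = 1#

  -- Extended Stirling numbers S_{2,r}(n,k):  F_k(t) = f(t)^k / k! = Σ_n S_{2,r}(n,k) t^n/n!.
  -- F_k is determined by F_0 = 1, F_k(0) = 0 (k ≥ 1) and F_k' = f' · F_{k-1}, i.e.
  -- S_{2,r}(n+1,k+1) = Σ_{i=0}^{n} C(n,i) a_{i+1} S_{2,r}(n-i,k).
  S₂ᵣ : Carrier → ℕ → ℕ → Carrier
  S₂ᵣ r zero    zero    = 1#
  S₂ᵣ r zero    (suc k) = 0#
  S₂ᵣ r (suc n) zero    = 0#
  S₂ᵣ r (suc n) (suc k) =
    Σ< (suc n) (λ i → ι (n C i) * (egfCoeff r (suc i) * S₂ᵣ r (n ∸ i) k))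

{-# OPTIONS --safe #-}
-- Work in the ring of exponential generating functions over R. Writing γₖ(a) for the divided
-- power aᵏ/k! (defined by γₖ₊₁′ = a′ γₖ, so no division is needed), S_{2,r}(·,k) = γₖ(f) for
-- f = e^t − 1 + rt and S₂(·,k) = γₖ(e^t − 1). Comparing values at 0 and derivatives gives
-- γₘ γₖ = C(m+k,m) γₘ₊ₖ and the binomial formula γₘ(a + b) = Σₗ γₗ(a) γₘ₋ₗ(b). So
-- C(m+k,m) γₘ₊ₖ(f) = γₘ(f) γₖ(f); expanding both factors with f = rt + (e^t − 1) and
-- γₗ(rt) = (rt)ˡ/l! gives the triple sum, where the terms with n₁ < m vanish as γₘ(f) has order m.
module Submission where

open import Defs
open import Level using (Level)
open import Data.Nat as ℕ using (ℕ; zero; suc; _∸_; _≤_; _<_; s≤s)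
import Data.Nat.Properties as ℕₚ
open ℕₚ
  using ( _<?_; ≮⇒≥; n<1+n; m<n⇒m<1+n; ≤-<-trans; m≤n⇒m≤1+n; m+n≤o⇒m≤o; +-suc
        ; m∸n≤m; n∸n≡0; +-∸-assoc; m+[n∸m]≡n)
open import Data.Nat.Combinatorics using (_C_; nCn≡1; nCk+nC[k+1]≡[n+1]C[k+1])
open import Data.Nat.Combinatorics.Specification using (k>n⇒nCk≡0)
open import Algebra.Bundles using (CommutativeRing)
open import Relation.Binary.PropositionalEquality as ≡ using (_≡_)
open import Data.Product using (_,_)
open import Relation.Nullary using (yes; no)

module FiniteSums {c ℓ : Level} (R : CommutativeRing c ℓ) where
  open CommutativeRing R
  open import Relation.Binary.Reasoning.Setoid setoid
  open import Algebra.Properties.Semiring.Mult semiring using (_×_; ×-homo-+; ×1-homo-*)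
  open import Algebra.Properties.Semiring.Exp semiring using (_^_; ^-homo-*)
  open import Algebra.Properties.CommutativeSemigroup +-commutativeSemigroup
    using (interchange; x∙yz≈xz∙y)

  Σ<-cong : ∀ n {f g : ℕ → Carrier} → (∀ i → f i ≈ g i) → Σ< R n f ≈ Σ< R n g
  Σ<-cong zero    f≈g = refl
  Σ<-cong (suc n) f≈g = +-cong (Σ<-cong n f≈g) (f≈g n)

  Σ<-cong-< : ∀ n {f g : ℕ → Carrier} → (∀ {i} → i < n → f i ≈ g i) → Σ< R n f ≈ Σ< R n g
  Σ<-cong-< zero    f≈g = refl
  Σ<-cong-< (suc n) f≈g = +-cong (Σ<-cong-< n (λ i<n → f≈g (m<n⇒m<1+n i<n))) (f≈g (n<1+n n))

  Σ<-zero-< : ∀ n {f : ℕ → Carrier} → (∀ {i} → i < n → f i ≈ 0#) → Σ< R n f ≈ 0#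
  Σ<-zero-< zero    f≈0 = refl
  Σ<-zero-< (suc n) f≈0 =
    trans (+-cong (Σ<-zero-< n (λ i<n → f≈0 (m<n⇒m<1+n i<n))) (f≈0 (n<1+n n))) (+-identityˡ 0#)

  Σ<-+ : ∀ n (f g : ℕ → Carrier) → Σ< R n (λ i → f i + g i) ≈ Σ< R n f + Σ< R n g
  Σ<-+ zero    f g = sym (+-identityˡ 0#)
  Σ<-+ (suc n) f g = begin
    Σ< R n (λ i → f i + g i) + (f n + g n) ≈⟨ +-congʳ (Σ<-+ n f g) ⟩
    (Σ< R n f + Σ< R n g) + (f n + g n)     ≈⟨ interchange _ _ _ _ ⟩
    (Σ< R n f + f n) + (Σ< R n g + g n)     ∎

  *-distribˡ-Σ< : ∀ n x (f : ℕ → Carrier) → x * Σ< R n f ≈ Σ< R n (λ i → x * f i)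
  *-distribˡ-Σ< zero    x f = zeroʳ x
  *-distribˡ-Σ< (suc n) x f = trans (distribˡ x _ _) (+-congʳ (*-distribˡ-Σ< n x f))

  *-distribʳ-Σ< : ∀ n x (f : ℕ → Carrier) → Σ< R n f * x ≈ Σ< R n (λ i → f i * x)
  *-distribʳ-Σ< zero    x f = zeroˡ x
  *-distribʳ-Σ< (suc n) x f = trans (distribʳ x _ _) (+-congʳ (*-distribʳ-Σ< n x f))

  Σ<-*-Σ< : ∀ m n (f g : ℕ → Carrier) →
            Σ< R m f * Σ< R n g ≈ Σ< R m (λ i → Σ< R n (λ j → f i * g j))
  Σ<-*-Σ< m n f g =
    trans (*-distribʳ-Σ< m _ f) (Σ<-cong m (λ i → *-distribˡ-Σ< n (f i) g))

  Σ<-suc : ∀ n (f : ℕ → Carrier) → Σ< R (suc n) f ≈ f 0 + Σ< R n (λ i → f (suc i))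
  Σ<-suc zero    f = trans (+-identityˡ _) (sym (+-identityʳ _))
  Σ<-suc (suc n) f = trans (+-congʳ (Σ<-suc n f)) (+-assoc _ _ _)

  Σ<-+-split : ∀ m n (f : ℕ → Carrier) → Σ< R (m ℕ.+ n) f ≈ Σ< R m f + Σ< R n (λ i → f (m ℕ.+ i))
  Σ<-+-split zero    n f = sym (+-identityˡ _)
  Σ<-+-split (suc m) n f = begin
    Σ< R (suc m ℕ.+ n) f ≈⟨ Σ<-suc (m ℕ.+ n) f ⟩
    f 0 + Σ< R (m ℕ.+ n) (λ i → f (suc i)) ≈⟨ +-congˡ (Σ<-+-split m n (λ i → f (suc i))) ⟩
    f 0 + (Σ< R m (λ i → f (suc i)) + Σ< R n (λ i → f (suc m ℕ.+ i))) ≈⟨ +-assoc _ _ _ ⟨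
    (f 0 + Σ< R m (λ i → f (suc i))) + Σ< R n (λ i → f (suc m ℕ.+ i)) ≈⟨ +-congʳ (Σ<-suc m f) ⟨
    Σ< R (suc m) f + Σ< R n (λ i → f (suc m ℕ.+ i)) ∎

  Σ<-drop : ∀ {m N} (f : ℕ → Carrier) → m ≤ N → (∀ {i} → i < m → f i ≈ 0#) →
            Σ< R N f ≈ Σ< R (N ∸ m) (λ i → f (m ℕ.+ i))
  Σ<-drop {m} {N} f m≤N f≈0 = begin
    Σ< R N f                                         ≡⟨ ≡.cong (λ N → Σ< R N f) (m+[n∸m]≡n m≤N) ⟨
    Σ< R (m ℕ.+ (N ∸ m)) f                           ≈⟨ Σ<-+-split m (N ∸ m) f ⟩
    Σ< R m f + Σ< R (N ∸ m) (λ i → f (m ℕ.+ i))      ≈⟨ +-congʳ (Σ<-zero-< m f≈0) ⟩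
    0# + Σ< R (N ∸ m) (λ i → f (m ℕ.+ i))            ≈⟨ +-identityˡ _ ⟩
    Σ< R (N ∸ m) (λ i → f (m ℕ.+ i))                 ∎

  ι≡×1# : ∀ n → ι R n ≡ n × 1#
  ι≡×1# zero    = ≡.refl
  ι≡×1# (suc n) = ≡.cong (1# +_) (ι≡×1# n)

  ι-+ : ∀ m n → ι R (m ℕ.+ n) ≈ ι R m + ι R n
  ι-+ m n rewrite ι≡×1# (m ℕ.+ n) | ι≡×1# m | ι≡×1# n = ×-homo-+ 1# m n

  ι-* : ∀ m n → ι R (m ℕ.* n) ≈ ι R m * ι R n
  ι-* m n rewrite ι≡×1# (m ℕ.* n) | ι≡×1# m | ι≡×1# n = ×1-homo-* m n

  ι-1 : ι R 1 ≈ 1#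
  ι-1 = +-identityʳ 1#

  ι-sumℕ : ∀ n f → ι R (sumℕ n f) ≈ Σ< R n (λ i → ι R (f i))
  ι-sumℕ zero    f = refl
  ι-sumℕ (suc n) f = trans (ι-+ (sumℕ n f) (f n)) (+-congʳ (ι-sumℕ n f))

  ι-pascal : ∀ n k → ι R (suc n C suc k) ≈ ι R (n C k) + ι R (n C suc k)
  ι-pascal n k = trans (reflexive (≡.cong (ι R) (≡.sym (nCk+nC[k+1]≡[n+1]C[k+1] n k))))
                       (ι-+ (n C k) (n C suc k))

  ι-C-vanish : ∀ {n k} → n < k → ι R (n C k) ≈ 0#
  ι-C-vanish n<k = reflexive (≡.cong (ι R) (k>n⇒nCk≡0 n<k))

  pow≡^ : ∀ x n → pow R x n ≡ x ^ n
  pow≡^ x zero    = ≡.refl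
  pow≡^ x (suc n) = ≡.cong (x *_) (pow≡^ x n)

  pow-+ : ∀ x m n → pow R x (m ℕ.+ n) ≈ pow R x m * pow R x n
  pow-+ x m n rewrite pow≡^ x (m ℕ.+ n) | pow≡^ x m | pow≡^ x n = ^-homo-* x m n

  Σ<-pascal : ∀ n (f : ℕ → Carrier) →
              Σ< R (suc (suc n)) (λ i → ι R (suc n C i) * f i)
              ≈ Σ< R (suc (suc n)) (λ i → ι R (n C i) * f i) + Σ< R (suc n) (λ i → ι R (n C i) * f (suc i))
  Σ<-pascal n f = begin
    Σ< R (suc (suc n)) (λ i → ι R (suc n C i) * f i)
      ≈⟨ Σ<-suc (suc n) _ ⟩
    ι R 1 * f 0 + Σ< R (suc n) (λ i → ι R (suc n C suc i) * f (suc i))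
      ≈⟨ +-congˡ (Σ<-cong (suc n) (λ i → trans (*-congʳ (ι-pascal n i)) (distribʳ _ _ _))) ⟩
    ι R 1 * f 0 + Σ< R (suc n) (λ i → ι R (n C i) * f (suc i) + ι R (n C suc i) * f (suc i))
      ≈⟨ +-congˡ (Σ<-+ (suc n) _ _) ⟩
    ι R 1 * f 0 + (shifted + upper)
      ≈⟨ x∙yz≈xz∙y _ _ _ ⟩
    (ι R 1 * f 0 + upper) + shifted
      ≈⟨ +-congʳ (Σ<-suc (suc n) (λ i → ι R (n C i) * f i)) ⟨
    Σ< R (suc (suc n)) (λ i → ι R (n C i) * f i) + shifted ∎
    where
    shifted upper : Carrier
    shifted = Σ< R (suc n) (λ i → ι R (n C i) * f (suc i))
    upper   = Σ< R (suc n) (λ i → ι R (n C suc i) * f (suc i))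

module ExponentialGeneratingFunctions {c ℓ : Level} (R : CommutativeRing c ℓ) where
  open CommutativeRing R
  open FiniteSums R
  open import Relation.Binary.Reasoning.Setoid setoid
  open import Algebra.Properties.CommutativeSemigroup *-commutativeSemigroup
    using (x∙yz≈y∙xz)
  import Algebra.Construct.Pointwise ℕ as Pointwise

  -- A sequence a stands for the series Σ aₙ tⁿ/n!: ⊛ is the product, D the derivative,
  -- δ the series 1 and X the series t.
  Seq : Set c
  Seq = ℕ → Carrier

  infix  4 _≋_
  infixl 6 _⊕_
  infixl 7 _⊛_
  infixr 7 _∙_

  _≋_ : Seq → Seq → Set ℓ
  a ≋ b = ∀ n → a n ≈ b n

  _⊕_ : Seq → Seq → Seq
  (a ⊕ b) n = a n + b n

  ⊝_ : Seq → Seq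
  (⊝ a) n = - a n

  𝟘 : Seq
  𝟘 _ = 0#

  δ : Seq
  δ zero    = 1#
  δ (suc _) = 0#

  _∙_ : Carrier → Seq → Seq
  (x ∙ a) n = x * a n

  _⊛_ : Seq → Seq → Seq
  (a ⊛ b) n = Σ< R (suc n) (λ i → ι R (n C i) * (a i * b (n ∸ i)))

  D : Seq → Seq
  D a n = a (suc n)

  X : Seq
  X zero    = 0#
  X (suc n) = δ n

  ⊛-cong : ∀ {a a′ b b′} → a ≋ a′ → b ≋ b′ → a ⊛ b ≋ a′ ⊛ b′
  ⊛-cong a≋a′ b≋b′ n = Σ<-cong (suc n) (λ i → *-congˡ (*-cong (a≋a′ i) (b≋b′ (n ∸ i))))

  ⊛-congˡ : ∀ {a b b′} → b ≋ b′ → a ⊛ b ≋ a ⊛ b′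
  ⊛-congˡ = ⊛-cong (λ _ → refl)

  ⊛-congʳ : ∀ {a a′ b} → a ≋ a′ → a ⊛ b ≋ a′ ⊛ b
  ⊛-congʳ {b = b} a≋a′ = ⊛-cong {b = b} a≋a′ (λ _ → refl)

  ⊛-at-0 : ∀ a b → (a ⊛ b) 0 ≈ a 0 * b 0
  ⊛-at-0 a b = trans (+-identityˡ _) (trans (*-congʳ ι-1) (*-identityˡ _))

  leibniz : ∀ a b → D (a ⊛ b) ≋ D a ⊛ b ⊕ a ⊛ D b
  leibniz a b n = begin
    Σ< R (suc (suc n)) (λ i → ι R (suc n C i) * (a i * b (suc n ∸ i)))
      ≈⟨ Σ<-pascal n (λ i → a i * b (suc n ∸ i)) ⟩
    Σ< R (suc n) (λ i → ι R (n C i) * (a i * b (suc n ∸ i))) + ι R (n C suc n) * (a (suc n) * b (n ∸ n))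
      + (D a ⊛ b) n
      ≈⟨ +-congʳ (+-cong (Σ<-cong-< (suc n) suc-∸) (trans (*-congʳ (ι-C-vanish (n<1+n n))) (zeroˡ _))) ⟩
    (a ⊛ D b) n + 0# + (D a ⊛ b) n
      ≈⟨ trans (+-congʳ (+-identityʳ _)) (+-comm _ _) ⟩
    (D a ⊛ b) n + (a ⊛ D b) n ∎
    where
    suc-∸ : ∀ {i} → i < suc n → ι R (n C i) * (a i * b (suc n ∸ i)) ≈ ι R (n C i) * (a i * D b (n ∸ i))
    suc-∸ {i} (s≤s i≤n) = reflexive (≡.cong (λ j → ι R (n C i) * (a i * b j)) (+-∸-assoc 1 i≤n))

  ⊛-distribʳ : ∀ e a b → (a ⊕ b) ⊛ e ≋ a ⊛ e ⊕ b ⊛ e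
  ⊛-distribʳ e a b n =
    trans (Σ<-cong (suc n) (λ i → trans (*-congˡ (distribʳ _ _ _)) (distribˡ _ _ _))) (Σ<-+ (suc n) _ _)

  ⊛-distribˡ : ∀ a b e → a ⊛ (b ⊕ e) ≋ a ⊛ b ⊕ a ⊛ e
  ⊛-distribˡ a b e n =
    trans (Σ<-cong (suc n) (λ i → trans (*-congˡ (distribˡ _ _ _)) (distribˡ _ _ _))) (Σ<-+ (suc n) _ _)

  ∙-⊛ : ∀ x a b → (x ∙ a) ⊛ b ≋ x ∙ (a ⊛ b)
  ∙-⊛ x a b n = trans (Σ<-cong (suc n) (λ i → trans (*-congˡ (*-assoc _ _ _)) (x∙yz≈y∙xz _ _ _)))
                      (sym (*-distribˡ-Σ< (suc n) x _))

  ⊛-∙ : ∀ x a b → a ⊛ (x ∙ b) ≋ x ∙ (a ⊛ b)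
  ⊛-∙ x a b n = trans (Σ<-cong (suc n) (λ i → trans (*-congˡ (x∙yz≈y∙xz _ _ _)) (x∙yz≈y∙xz _ _ _)))
                      (sym (*-distribˡ-Σ< (suc n) x _))

  δ-⊛ : ∀ a → δ ⊛ a ≋ a
  δ-⊛ a n = begin
    (δ ⊛ a) n
      ≈⟨ Σ<-suc n _ ⟩
    ι R 1 * (1# * a n) + Σ< R n (λ i → ι R (n C suc i) * (0# * a (n ∸ suc i)))
      ≈⟨ +-cong (trans (*-congʳ ι-1) (trans (*-identityˡ _) (*-identityˡ _)))
                (Σ<-zero-< n (λ _ → trans (*-congˡ (zeroˡ _)) (zeroʳ _))) ⟩
    a n + 0#
      ≈⟨ +-identityʳ _ ⟩
    a n ∎

  ⊛-comm : ∀ a b → a ⊛ b ≋ b ⊛ a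
  ⊛-comm a b zero    = trans (⊛-at-0 a b) (trans (*-comm _ _) (sym (⊛-at-0 b a)))
  ⊛-comm a b (suc n) = begin
    (a ⊛ b) (suc n)           ≈⟨ leibniz a b n ⟩
    (D a ⊛ b) n + (a ⊛ D b) n ≈⟨ +-cong (⊛-comm (D a) b n) (⊛-comm a (D b) n) ⟩
    (b ⊛ D a) n + (D b ⊛ a) n ≈⟨ +-comm _ _ ⟩
    (D b ⊛ a) n + (b ⊛ D a) n ≈⟨ leibniz b a n ⟨
    (b ⊛ a) (suc n)           ∎

  ⊛-δ : ∀ a → a ⊛ δ ≋ a
  ⊛-δ a n = trans (⊛-comm a δ n) (δ-⊛ a n)

  ⊛-assoc : ∀ a b e → (a ⊛ b) ⊛ e ≋ a ⊛ (b ⊛ e)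
  ⊛-assoc a b e zero = begin
    ((a ⊛ b) ⊛ e) 0    ≈⟨ trans (⊛-at-0 (a ⊛ b) e) (*-congʳ (⊛-at-0 a b)) ⟩
    (a 0 * b 0) * e 0  ≈⟨ *-assoc _ _ _ ⟩
    a 0 * (b 0 * e 0)  ≈⟨ trans (⊛-at-0 a (b ⊛ e)) (*-congˡ (⊛-at-0 b e)) ⟨
    (a ⊛ (b ⊛ e)) 0    ∎
  ⊛-assoc a b e (suc n) = begin
    ((a ⊛ b) ⊛ e) (suc n)
      ≈⟨ leibniz (a ⊛ b) e n ⟩
    (D (a ⊛ b) ⊛ e) n + ((a ⊛ b) ⊛ D e) n
      ≈⟨ +-congʳ (⊛-congʳ {b = e} (leibniz a b) n) ⟩
    ((D a ⊛ b ⊕ a ⊛ D b) ⊛ e) n + ((a ⊛ b) ⊛ D e) n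
      ≈⟨ +-congʳ (⊛-distribʳ e (D a ⊛ b) (a ⊛ D b) n) ⟩
    ((D a ⊛ b) ⊛ e) n + ((a ⊛ D b) ⊛ e) n + ((a ⊛ b) ⊛ D e) n
      ≈⟨ +-cong (+-cong (⊛-assoc (D a) b e n) (⊛-assoc a (D b) e n)) (⊛-assoc a b (D e) n) ⟩
    (D a ⊛ (b ⊛ e)) n + (a ⊛ (D b ⊛ e)) n + (a ⊛ (b ⊛ D e)) n
      ≈⟨ +-assoc _ _ _ ⟩
    (D a ⊛ (b ⊛ e)) n + ((a ⊛ (D b ⊛ e)) n + (a ⊛ (b ⊛ D e)) n)
      ≈⟨ +-congˡ (⊛-distribˡ a (D b ⊛ e) (b ⊛ D e) n) ⟨
    (D a ⊛ (b ⊛ e)) n + (a ⊛ (D b ⊛ e ⊕ b ⊛ D e)) n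
      ≈⟨ +-congˡ (⊛-congˡ (leibniz b e) n) ⟨
    (D a ⊛ (b ⊛ e)) n + (a ⊛ D (b ⊛ e)) n
      ≈⟨ leibniz a (b ⊛ e) n ⟨
    (a ⊛ (b ⊛ e)) (suc n) ∎

  egfRing : CommutativeRing c ℓ
  egfRing = record
    { Carrier = Seq
    ; _≈_ = _≋_
    ; _+_ = _⊕_
    ; _*_ = _⊛_
    ; -_ = ⊝_
    ; 0# = 𝟘
    ; 1# = δ
    ; isCommutativeRing = record
      { isRing = record
        { +-isAbelianGroup = Pointwise.isAbelianGroup +-isAbelianGroup
        ; *-cong = ⊛-cong
        ; *-assoc = ⊛-assoc
        ; *-identity = δ-⊛ , ⊛-δ
        ; distrib = ⊛-distribˡ , ⊛-distribʳ
        }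
      ; *-comm = ⊛-comm
      }
    }

  Σ<-apply : ∀ N (F : ℕ → Seq) n → Σ< egfRing N F n ≈ Σ< R N (λ i → F i n)
  Σ<-apply zero    F n = refl
  Σ<-apply (suc N) F n = +-congʳ (Σ<-apply N F n)

  D-Σ< : ∀ N (F : ℕ → Seq) → D (Σ< egfRing N F) ≋ Σ< egfRing N (λ i → D (F i))
  D-Σ< zero    F n = refl
  D-Σ< (suc N) F n = +-congʳ (D-Σ< N F n)

  ≋-from-D : ∀ {a b} → a 0 ≈ b 0 → D a ≋ D b → a ≋ b
  ≋-from-D a₀≈b₀ Da≋Db zero    = a₀≈b₀
  ≋-from-D a₀≈b₀ Da≋Db (suc n) = Da≋Db n

module DividedPowers {c ℓ : Level} (R : CommutativeRing c ℓ) where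
  open CommutativeRing R
  open FiniteSums R
  open ExponentialGeneratingFunctions R
  module Σₑ = FiniteSums egfRing
  open CommutativeRing egfRing using ()
    renaming ( setoid to egfSetoid; +-cong to ⊕-cong; +-identityˡ to ⊕-identityˡ
             ; +-identityʳ to ⊕-identityʳ; zeroˡ to ⊛-zeroˡ; zeroʳ to ⊛-zeroʳ)
  open import Algebra.Properties.CommutativeSemigroup (CommutativeRing.*-commutativeSemigroup egfRing)
    using () renaming (x∙yz≈y∙xz to ⊛-x∙yz≈y∙xz)
  open import Algebra.Properties.CommutativeSemigroup *-commutativeSemigroup
    using (x∙yz≈y∙xz)
  import Relation.Binary.Reasoning.Setoid
  module ≋-Reasoning = Relation.Binary.Reasoning.Setoid egfSetoid
  module ≈-Reasoning = Relation.Binary.Reasoning.Setoid setoid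

  -- The divided power (a − a₀)ᵏ/k!.
  γ : ℕ → Seq → Seq
  γ zero    a n       = δ n
  γ (suc k) a zero    = 0#
  γ (suc k) a (suc n) = (D a ⊛ γ k a) n

  γ-congᴰ : ∀ k {a b} → D a ≋ D b → γ k a ≋ γ k b
  γ-congᴰ zero    Da≋Db n       = refl
  γ-congᴰ (suc k) Da≋Db zero    = refl
  γ-congᴰ (suc k) Da≋Db (suc n) = ⊛-cong Da≋Db (γ-congᴰ k Da≋Db) n

  γ-vanish : ∀ {k n} a → n < k → γ k a n ≈ 0#
  γ-vanish {suc k} {zero}  a _         = refl
  γ-vanish {suc k} {suc n} a (s≤s n<k) =
    Σ<-zero-< (suc n) (λ {i} _ →
      trans (*-congˡ (trans (*-congˡ (γ-vanish a (≤-<-trans (m∸n≤m n i) n<k))) (zeroʳ _))) (zeroʳ _))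

  γ-product : ∀ m k a → γ m a ⊛ γ k a ≋ ι R ((m ℕ.+ k) C m) ∙ γ (m ℕ.+ k) a
  γ-product zero    k       a n = trans (δ-⊛ (γ k a) n) (sym (trans (*-congʳ ι-1) (*-identityˡ _)))
  γ-product (suc m) zero    a n rewrite ℕₚ.+-identityʳ m =
    trans (⊛-δ (γ (suc m) a) n) (sym (trans (*-congʳ ιCnn) (*-identityˡ _)))
    where
    ιCnn : ι R (suc m C suc m) ≈ 1#
    ιCnn = trans (reflexive (≡.cong (ι R) (nCn≡1 (suc m)))) ι-1
  γ-product (suc m) (suc k) a rewrite +-suc m k = ≋-from-D at-0 D-step
    where
    N : ℕ
    N = suc (m ℕ.+ k)
    ih : γ m a ⊛ γ (suc k) a ≋ ι R (N C m) ∙ γ N a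
    ih = ≡.subst (λ j → γ m a ⊛ γ (suc k) a ≋ ι R (j C m) ∙ γ j a) (+-suc m k) (γ-product m (suc k) a)
    at-0 : (γ (suc m) a ⊛ γ (suc k) a) 0 ≈ ι R (suc N C suc m) * 0#
    at-0 = trans (⊛-at-0 (γ (suc m) a) (γ (suc k) a)) (trans (zeroˡ 0#) (sym (zeroʳ _)))
    D-step : D (γ (suc m) a ⊛ γ (suc k) a) ≋ ι R (suc N C suc m) ∙ D (γ (suc N) a)
    D-step = begin
      D (γ (suc m) a ⊛ γ (suc k) a)
        ≈⟨ leibniz (γ (suc m) a) (γ (suc k) a) ⟩
      (D a ⊛ γ m a) ⊛ γ (suc k) a ⊕ γ (suc m) a ⊛ (D a ⊛ γ k a)
        ≈⟨ ⊕-cong (⊛-assoc (D a) (γ m a) (γ (suc k) a)) (⊛-x∙yz≈y∙xz (γ (suc m) a) (D a) (γ k a)) ⟩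
      D a ⊛ (γ m a ⊛ γ (suc k) a) ⊕ D a ⊛ (γ (suc m) a ⊛ γ k a)
        ≈⟨ ⊕-cong (⊛-congˡ ih) (⊛-congˡ (γ-product (suc m) k a)) ⟩
      D a ⊛ (ι R (N C m) ∙ γ N a) ⊕ D a ⊛ (ι R (N C suc m) ∙ γ N a)
        ≈⟨ ⊕-cong (⊛-∙ _ (D a) (γ N a)) (⊛-∙ _ (D a) (γ N a)) ⟩
      ι R (N C m) ∙ (D a ⊛ γ N a) ⊕ ι R (N C suc m) ∙ (D a ⊛ γ N a)
        ≈⟨ (λ _ → sym (distribʳ _ _ _)) ⟩
      (ι R (N C m) + ι R (N C suc m)) ∙ (D a ⊛ γ N a)
        ≈⟨ (λ _ → *-congʳ (ι-pascal N m)) ⟨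
      ι R (suc N C suc m) ∙ D (γ (suc N) a) ∎
      where open ≋-Reasoning

  γ-binomial : ∀ m a b → γ m (a ⊕ b) ≋ Σ< egfRing (suc m) (λ l → γ l a ⊛ γ (m ∸ l) b)
  γ-binomial zero    a b n = sym (trans (+-identityˡ _) (δ-⊛ δ n))
  γ-binomial (suc m) a b = ≋-from-D at-0 D-step
    where
    open ≋-Reasoning

    G : ℕ → Seq
    G j = Σ< egfRing (suc j) (λ l → γ l a ⊛ γ (j ∸ l) b)

    at-0 : 0# ≈ G (suc m) 0
    at-0 = sym (trans (Σ<-apply (suc (suc m)) _ 0) (Σ<-zero-< (suc (suc m)) term-at-0))
      where
      term-at-0 : ∀ {l} → l < suc (suc m) → (γ l a ⊛ γ (suc m ∸ l) b) 0 ≈ 0#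
      term-at-0 {zero}  _ = trans (⊛-at-0 δ (γ (suc m) b)) (zeroʳ _)
      term-at-0 {suc l} _ = trans (⊛-at-0 (γ (suc l) a) (γ (m ∸ l) b)) (zeroˡ _)

    differentiate-left : Σ< egfRing (suc (suc m)) (λ l → D (γ l a) ⊛ γ (suc m ∸ l) b) ≋ D a ⊛ G m
    differentiate-left = begin
      Σ< egfRing (suc (suc m)) (λ l → D (γ l a) ⊛ γ (suc m ∸ l) b)
        ≈⟨ Σₑ.Σ<-suc (suc m) _ ⟩
      D δ ⊛ γ (suc m) b ⊕ Σ< egfRing (suc m) (λ l → (D a ⊛ γ l a) ⊛ γ (m ∸ l) b)
        ≈⟨ ⊕-cong (⊛-zeroˡ (γ (suc m) b))
                  (Σₑ.Σ<-cong (suc m) (λ l → ⊛-assoc (D a) (γ l a) (γ (m ∸ l) b))) ⟩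
      𝟘 ⊕ Σ< egfRing (suc m) (λ l → D a ⊛ (γ l a ⊛ γ (m ∸ l) b))
        ≈⟨ ⊕-identityˡ _ ⟩
      Σ< egfRing (suc m) (λ l → D a ⊛ (γ l a ⊛ γ (m ∸ l) b))
        ≈⟨ Σₑ.*-distribˡ-Σ< (suc m) (D a) _ ⟨
      D a ⊛ G m ∎

    differentiate-right : Σ< egfRing (suc (suc m)) (λ l → γ l a ⊛ D (γ (suc m ∸ l) b)) ≋ D b ⊛ G m
    differentiate-right = begin
      Σ< egfRing (suc (suc m)) (λ l → γ l a ⊛ D (γ (suc m ∸ l) b))
        ≈⟨ ⊕-cong (Σₑ.Σ<-cong-< (suc m) suc-∸) last-vanishes ⟩
      Σ< egfRing (suc m) (λ l → γ l a ⊛ (D b ⊛ γ (m ∸ l) b)) ⊕ 𝟘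
        ≈⟨ ⊕-identityʳ _ ⟩
      Σ< egfRing (suc m) (λ l → γ l a ⊛ (D b ⊛ γ (m ∸ l) b))
        ≈⟨ Σₑ.Σ<-cong (suc m) (λ l → ⊛-x∙yz≈y∙xz (γ l a) (D b) (γ (m ∸ l) b)) ⟩
      Σ< egfRing (suc m) (λ l → D b ⊛ (γ l a ⊛ γ (m ∸ l) b))
        ≈⟨ Σₑ.*-distribˡ-Σ< (suc m) (D b) _ ⟨
      D b ⊛ G m ∎
      where
      suc-∸ : ∀ {l} → l < suc m → γ l a ⊛ D (γ (suc m ∸ l) b) ≋ γ l a ⊛ (D b ⊛ γ (m ∸ l) b)
      suc-∸ {l} (s≤s l≤m) rewrite +-∸-assoc 1 l≤m = λ _ → refl
      last-vanishes : γ (suc m) a ⊛ D (γ (m ∸ m) b) ≋ 𝟘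
      last-vanishes rewrite n∸n≡0 m = ⊛-zeroʳ (γ (suc m) a)

    D-step : D (a ⊕ b) ⊛ γ m (a ⊕ b) ≋ D (G (suc m))
    D-step = begin
      D (a ⊕ b) ⊛ γ m (a ⊕ b)
        ≈⟨ ⊛-congˡ (γ-binomial m a b) ⟩
      (D a ⊕ D b) ⊛ G m
        ≈⟨ ⊛-distribʳ (G m) (D a) (D b) ⟩
      D a ⊛ G m ⊕ D b ⊛ G m
        ≈⟨ ⊕-cong differentiate-left differentiate-right ⟨
      Σ< egfRing (suc (suc m)) (λ l → D (γ l a) ⊛ γ (suc m ∸ l) b)
        ⊕ Σ< egfRing (suc (suc m)) (λ l → γ l a ⊛ D (γ (suc m ∸ l) b))
        ≈⟨ Σₑ.Σ<-+ (suc (suc m)) _ _ ⟨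
      Σ< egfRing (suc (suc m)) (λ l → D (γ l a) ⊛ γ (suc m ∸ l) b ⊕ γ l a ⊛ D (γ (suc m ∸ l) b))
        ≈⟨ Σₑ.Σ<-cong (suc (suc m)) (λ l → leibniz (γ l a) (γ (suc m ∸ l) b)) ⟨
      Σ< egfRing (suc (suc m)) (λ l → D (γ l a ⊛ γ (suc m ∸ l) b))
        ≈⟨ D-Σ< (suc (suc m)) _ ⟨
      D (G (suc m)) ∎

  γ-monomial-⊛ : ∀ x l e n → (γ l (x ∙ X) ⊛ e) n ≈ ι R (n C l) * (pow R x l * e (n ∸ l))
  γ-monomial-⊛ x zero    e n       =
    trans (δ-⊛ e n) (sym (trans (*-congʳ ι-1) (trans (*-identityˡ _) (*-identityˡ _))))
  γ-monomial-⊛ x (suc l) e zero    = trans (⊛-at-0 (γ (suc l) (x ∙ X)) e) (trans (zeroˡ _) (sym (zeroˡ _)))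
  γ-monomial-⊛ x (suc l) e (suc n) = begin
    (γ (suc l) (x ∙ X) ⊛ e) (suc n)
      ≈⟨ leibniz (γ (suc l) (x ∙ X)) e n ⟩
    (((x ∙ δ) ⊛ g) ⊛ e) n + (γ (suc l) (x ∙ X) ⊛ D e) n
      ≈⟨ +-congʳ (trans (⊛-congʳ {b = e} (λ i → trans (∙-⊛ x δ g i) (*-congˡ (δ-⊛ g i))) n) (∙-⊛ x g e n)) ⟩
    x * (g ⊛ e) n + (γ (suc l) (x ∙ X) ⊛ D e) n
      ≈⟨ +-cong (*-congˡ (γ-monomial-⊛ x l e n)) (γ-monomial-⊛ x (suc l) (D e) n) ⟩
    x * (ι R (n C l) * (xˡ * e (n ∸ l))) + ι R (n C suc l) * (x * xˡ * D e (n ∸ suc l))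
      ≈⟨ +-cong (trans (x∙yz≈y∙xz _ _ _) (*-congˡ (sym (*-assoc _ _ _))))
                (shift-under-C (λ j → x * xˡ * e j)) ⟩
    ι R (n C l) * (x * xˡ * e (n ∸ l)) + ι R (n C suc l) * (x * xˡ * e (n ∸ l))
      ≈⟨ distribʳ _ _ _ ⟨
    (ι R (n C l) + ι R (n C suc l)) * (x * xˡ * e (n ∸ l))
      ≈⟨ *-congʳ (ι-pascal n l) ⟨
    ι R (suc n C suc l) * (x * xˡ * e (n ∸ l)) ∎
    where
    open ≈-Reasoning
    g : Seq
    g = γ l (x ∙ X)
    xˡ : Carrier
    xˡ = pow R x l
    shift-under-C : ∀ f → ι R (n C suc l) * f (suc (n ∸ suc l)) ≈ ι R (n C suc l) * f (n ∸ l)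
    shift-under-C f with l <? n
    ... | yes l<n = *-congˡ (reflexive (≡.cong f (≡.sym (+-∸-assoc 1 l<n))))
    ... | no  l≮n = trans (*-congʳ C≈0) (trans (zeroˡ _) (sym (trans (*-congʳ C≈0) (zeroˡ _))))
      where
      C≈0 : ι R (n C suc l) ≈ 0#
      C≈0 = ι-C-vanish (s≤s (≮⇒≥ l≮n))

module ExtendedStirlingNumbers {c ℓ : Level} (R : CommutativeRing c ℓ) (r : CommutativeRing.Carrier R) where
  open CommutativeRing R
  open FiniteSums R
  open ExponentialGeneratingFunctions R
  open DividedPowers R
  open import Relation.Binary.Reasoning.Setoid setoid
  open import Algebra.Solver.CommutativeMonoid *-commutativeMonoid
    using (solve; _⊜_) renaming (_⊕_ to _⊗_)

  expm1 : Seq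
  expm1 zero    = 0#
  expm1 (suc _) = 1#

  S₂≈γ-expm1 : ∀ k n → ι R (S₂ n k) ≈ γ k expm1 n
  S₂≈γ-expm1 zero    zero    = ι-1
  S₂≈γ-expm1 zero    (suc n) = refl
  S₂≈γ-expm1 (suc k) zero    = refl
  S₂≈γ-expm1 (suc k) (suc n) = trans (ι-sumℕ (suc n) _) (Σ<-cong (suc n) (λ i →
    trans (ι-* (n C i) (S₂ (n ∸ i) k)) (*-congˡ (trans (S₂≈γ-expm1 k (n ∸ i)) (sym (*-identityˡ _))))))

  S₂ᵣ≈γ : ∀ k n → S₂ᵣ R r n k ≈ γ k (egfCoeff R r) n
  S₂ᵣ≈γ zero    zero    = refl
  S₂ᵣ≈γ zero    (suc n) = refl
  S₂ᵣ≈γ (suc k) zero    = refl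
  S₂ᵣ≈γ (suc k) (suc n) = ⊛-congˡ (S₂ᵣ≈γ k) n

  D-egfCoeff : D (egfCoeff R r) ≋ D (r ∙ X ⊕ expm1)
  D-egfCoeff zero    = trans (+-comm 1# r) (+-congʳ (sym (*-identityʳ r)))
  D-egfCoeff (suc n) = sym (trans (+-congʳ (zeroʳ r)) (+-identityˡ 1#))

  S₂ᵣ-vanish : ∀ {n k} → n < k → S₂ᵣ R r n k ≈ 0#
  S₂ᵣ-vanish {n} {k} n<k = trans (S₂ᵣ≈γ k n) (γ-vanish (egfCoeff R r) n<k)

  S₂ᵣ-expansion : ∀ n m →
    S₂ᵣ R r n m ≈ Σ< R (suc m) (λ l → ι R (n C l) * (pow R r l * ι R (S₂ (n ∸ l) (m ∸ l))))
  S₂ᵣ-expansion n m = begin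
    S₂ᵣ R r n m
      ≈⟨ S₂ᵣ≈γ m n ⟩
    γ m (egfCoeff R r) n
      ≈⟨ γ-congᴰ m D-egfCoeff n ⟩
    γ m (r ∙ X ⊕ expm1) n
      ≈⟨ trans (γ-binomial m (r ∙ X) expm1 n) (Σ<-apply (suc m) _ n) ⟩
    Σ< R (suc m) (λ l → (γ l (r ∙ X) ⊛ γ (m ∸ l) expm1) n)
      ≈⟨ Σ<-cong (suc m) (λ l → ⊛-congˡ (λ j → sym (S₂≈γ-expm1 (m ∸ l) j)) n) ⟩
    Σ< R (suc m) (λ l → (γ l (r ∙ X) ⊛ (λ j → ι R (S₂ j (m ∸ l)))) n)
      ≈⟨ Σ<-cong (suc m) (λ l → γ-monomial-⊛ r l (λ j → ι R (S₂ j (m ∸ l))) n) ⟩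
    Σ< R (suc m) (λ l → ι R (n C l) * (pow R r l * ι R (S₂ (n ∸ l) (m ∸ l)))) ∎

  S₂ᵣ-convolution : ∀ n m k →
    ι R ((m ℕ.+ k) C m) * S₂ᵣ R r n (m ℕ.+ k)
    ≈ Σ< R (suc n) (λ n₁ → ι R (n C n₁) * (S₂ᵣ R r n₁ m * S₂ᵣ R r (n ∸ n₁) k))
  S₂ᵣ-convolution n m k = begin
    ι R ((m ℕ.+ k) C m) * S₂ᵣ R r n (m ℕ.+ k)
      ≈⟨ *-congˡ (S₂ᵣ≈γ (m ℕ.+ k) n) ⟩
    ι R ((m ℕ.+ k) C m) * γ (m ℕ.+ k) (egfCoeff R r) n
      ≈⟨ γ-product m k (egfCoeff R r) n ⟨
    (γ m (egfCoeff R r) ⊛ γ k (egfCoeff R r)) n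
      ≈⟨ ⊛-cong (λ j → sym (S₂ᵣ≈γ m j)) (λ j → sym (S₂ᵣ≈γ k j)) n ⟩
    Σ< R (suc n) (λ n₁ → ι R (n C n₁) * (S₂ᵣ R r n₁ m * S₂ᵣ R r (n ∸ n₁) k)) ∎

  convolution-term-vanishes : ∀ {m} n k {n₁} → n₁ < m →
    ι R (n C n₁) * (S₂ᵣ R r n₁ m * S₂ᵣ R r (n ∸ n₁) k) ≈ 0#
  convolution-term-vanishes n k n₁<m =
    trans (*-congˡ (trans (*-congʳ (S₂ᵣ-vanish n₁<m)) (zeroˡ _))) (zeroʳ _)

  convolution-term-expansion : ∀ n n₁ m k →
    ι R (n C n₁) * (S₂ᵣ R r n₁ m * S₂ᵣ R r (n ∸ n₁) k)
    ≈ Σ< R (suc m) (λ l → Σ< R (suc k) (λ j →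
        ι R (n₁ C l) * (ι R ((n ∸ n₁) C j) * (ι R (n C n₁) * (pow R r (l ℕ.+ j)
          * (ι R (S₂ (n₁ ∸ l) (m ∸ l)) * ι R (S₂ (n ∸ n₁ ∸ j) (k ∸ j))))))))
  convolution-term-expansion n n₁ m k = begin
    w * (S₂ᵣ R r n₁ m * S₂ᵣ R r (n ∸ n₁) k)
      ≈⟨ *-congˡ (*-cong (S₂ᵣ-expansion n₁ m) (S₂ᵣ-expansion (n ∸ n₁) k)) ⟩
    w * (Σ< R (suc m) A * Σ< R (suc k) B)
      ≈⟨ *-congˡ (Σ<-*-Σ< (suc m) (suc k) A B) ⟩
    w * Σ< R (suc m) (λ l → Σ< R (suc k) (λ j → A l * B j))
      ≈⟨ *-distribˡ-Σ< (suc m) w _ ⟩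
    Σ< R (suc m) (λ l → w * Σ< R (suc k) (λ j → A l * B j))
      ≈⟨ Σ<-cong (suc m) (λ l → *-distribˡ-Σ< (suc k) w _) ⟩
    Σ< R (suc m) (λ l → Σ< R (suc k) (λ j → w * (A l * B j)))
      ≈⟨ Σ<-cong (suc m) (λ l → Σ<-cong (suc k) (λ j →
           trans (rearrange _ _ _ _ _ _ _) (*-congˡ (*-congˡ (*-congˡ (*-congʳ (sym (pow-+ r l j)))))))) ⟩
    _ ∎
    where
    w : Carrier
    w = ι R (n C n₁)
    A B : ℕ → Carrier
    A l = ι R (n₁ C l) * (pow R r l * ι R (S₂ (n₁ ∸ l) (m ∸ l)))
    B j = ι R ((n ∸ n₁) C j) * (pow R r j * ι R (S₂ (n ∸ n₁ ∸ j) (k ∸ j)))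
    rearrange : ∀ w a b x y s t → w * ((a * (x * s)) * (b * (y * t))) ≈ a * (b * (w * ((x * y) * (s * t))))
    rearrange = solve 7 (λ w a b x y s t →
      w ⊗ ((a ⊗ (x ⊗ s)) ⊗ (b ⊗ (y ⊗ t))) ⊜ a ⊗ (b ⊗ (w ⊗ ((x ⊗ y) ⊗ (s ⊗ t))))) refl

open import Data.Nat using (_+_)
open CommutativeRing using (Carrier; _≈_; _*_)

mainTheorem8 : {c ℓ : Level} (R : CommutativeRing c ℓ) (r : Carrier R) (n m k : ℕ) →
    m + k ≤ n →
    _≈_ R (_*_ R (ι R ((m + k) C m)) (S₂ᵣ R r n (m + k)))
      (Σ[_⋯_] R m n (λ n₁ → Σ[_⋯_] R 0 m (λ l → Σ[_⋯_] R 0 k (λ j →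
        _*_ R (ι R (n₁ C l)) (_*_ R (ι R ((n ∸ n₁) C j)) (_*_ R (ι R (n C n₁))
          (_*_ R (pow R r (l + j))
            (_*_ R (ι R (S₂ (n₁ ∸ l) (m ∸ l))) (ι R (S₂ (n ∸ n₁ ∸ j) (k ∸ j)))))))))))
mainTheorem8 R r n m k m+k≤n =
  trans (S₂ᵣ-convolution n m k)
    (trans (Σ<-drop _ (m≤n⇒m≤1+n (m+n≤o⇒m≤o m m+k≤n)) (convolution-term-vanishes n k))
      (Σ<-cong (suc n ∸ m) (λ i → convolution-term-expansion n (m + i) m k)))
  where
  open CommutativeRing R using (trans)
  open FiniteSums R
  open ExtendedStirlingNumbers R r
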